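{- Let $k$ be a half-integer, let $h$ be a nonzero integer, and let $\ell\geq0$ be such that $2^\ell\mid h$ and $2^{\ell+1}\nmid h$. If $\alpha$ is an integer with $\alpha\geq \ell+4$, then \[ \sum_{\substack{d \bmod 2^\alpha\\ d \text{ odd}}} \varepsilon_d^{2k}\Big(\frac{2^\alpha}{d}\Big) e\Big(\frac{hd}{2^\alpha}\Big) = 0. \]
   Context: $e(x)=e^{2\pi i x}$. For odd $d$, $\varepsilon_d=1$ if $d\equiv1\pmod4$ and $\varepsilon_d=i$ if $d\equiv3\pmod4$; $\big(\frac{2^\alpha}{d}\big)$ is the Jacobi symbol. -}

module Defs where

open import Data.Nat as ℕ using (ℕ; zero; suc; _^_; _∸_; _<ᵇ_; _≡ᵇ_)
open import Data.Nat.Properties using (m^n≢0)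
open import Data.Bool using (Bool; true; false; if_then_else_)
open import Data.Fin as Fin using (Fin; toℕ)
open import Data.Integer as ℤ using (ℤ; +_; 0ℤ; 1ℤ; -1ℤ; _%ℕ_)
open import Data.List using (List; upTo; foldr)

-- The cyclotomic ring ℤ[ζ] ⊂ ℂ with ζ = e(1/2^α), α ≥ 1.
-- The minimal polynomial of ζ over ℚ is x^(2^(α-1)) + 1, so ℤ[ζ] is free
-- over ℤ with basis ζ^0, …, ζ^(2^(α-1) - 1); an element is represented by
-- its coefficient vector, and an element is 0 in ℂ iff all coefficients are 0.

half : ℕ → ℕ
half α = 2 ^ (α ∸ 1)

record Cyc (α : ℕ) : Set where
  constructor mkC
  field coeff : Fin (half α) → ℤ
open Cyc public

0C : ∀ {α} → Cyc α
0C = mkC (λ _ → 0ℤ)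

_+C_ : ∀ {α} → Cyc α → Cyc α → Cyc α
x +C y = mkC (λ i → coeff x i ℤ.+ coeff y i)

_·C_ : ∀ {α} → ℤ → Cyc α → Cyc α
c ·C x = mkC (λ i → c ℤ.* coeff x i)

basis : ∀ {α} → ℕ → Cyc α
basis r = mkC (λ i → if toℕ i ≡ᵇ r then 1ℤ else 0ℤ)

-- ζ^j = e(j / 2^α) for j : ℕ, using ζ^(2^α) = 1 and ζ^(2^(α-1)) = -1.
zetaPow : (α : ℕ) → ℕ → Cyc α
zetaPow α j with ℕ._%_ j (2 ^ α) {{m^n≢0 2 α}}
... | r with r <ᵇ half α
...   | true  = basis r
...   | false = -1ℤ ·C basis (r ∸ half α)

1C : ∀ {α} → Cyc α
1C {α} = zetaPow α 0

sumFin : ∀ {n} → (Fin n → ℤ) → ℤ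
sumFin {zero} f = 0ℤ
sumFin {suc n} f = f Fin.zero ℤ.+ sumFin (λ i → f (Fin.suc i))

_*C_ : ∀ {α} → Cyc α → Cyc α → Cyc α
_*C_ {α} x y = mkC (λ i →
  sumFin (λ a → sumFin (λ b →
    (coeff x a ℤ.* coeff y b) ℤ.* coeff (zetaPow α (toℕ a ℕ.+ toℕ b)) i)))

_^C_ : ∀ {α} → Cyc α → ℕ → Cyc α
x ^C zero = 1C
x ^C suc n = x *C (x ^C n)

e : (α : ℕ) → ℤ → Cyc α
e α j = zetaPow α (_%ℕ_ j (2 ^ α) {{m^n≢0 2 α}})

-- i = e(1/4) = ζ^(2^(α-2))   (meaningful for α ≥ 2)
iC : (α : ℕ) → Cyc α
iC α = zetaPow α (2 ^ (α ∸ 2))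

ε : (α : ℕ) → ℕ → Cyc α
ε α d = if (d ℕ.% 4) ≡ᵇ 1 then 1C else iC α

-- ε_d ^ m for an integer exponent m; since ε_d^4 = 1 this is ε_d^(m mod 4)
εPow : (α : ℕ) → ℕ → ℤ → Cyc α
εPow α d m = ε α d ^C (m %ℕ 4)

-- Jacobi symbol (2/d) for odd d (second supplementary law):
-- 1 if d ≡ ±1 (mod 8), -1 if d ≡ ±3 (mod 8)
jacobi2 : ℕ → ℤ
jacobi2 d with d ℕ.% 8
... | 1 = 1ℤ
... | 7 = 1ℤ
... | _ = -1ℤ

-- Jacobi symbol (2^α/d) = (2/d)^α (multiplicativity in the numerator)
jacobi2Pow : ℕ → ℕ → ℤ
jacobi2Pow zero d = 1ℤ
jacobi2Pow (suc α) d = jacobi2 d ℤ.* jacobi2Pow α d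

sumOdd : ∀ {α} → ℕ → (ℕ → Cyc α) → Cyc α
sumOdd N f = foldr (λ d acc → (if (d ℕ.% 2) ≡ᵇ 1 then f d else 0C) +C acc) 0C (upTo N)

-- S α m h = Σ_{d mod 2^α, d odd} ε_d^m (2^α/d) e(hd/2^α)   (m = 2k)
S : (α : ℕ) → (m h : ℤ) → Cyc α
S α m h = sumOdd (2 ^ α) (λ d →
  jacobi2Pow α d ·C (εPow α d m *C e α (h ℤ.* + d)))

module Submission where

-- Write α = a + 1, N = 2^α, H = 2^a, and let ζ = e(1/N), so that ζ^H = -1.
-- The idea is a sign-reversing shift of the summation variable.  If 2^ℓ
-- exactly divides h and α ≥ ℓ + 4, put t = 2^(α-ℓ-1); then h·t ≡ H (mod N),
-- so replacing d by d + t multiplies e(hd/N) by ζ^H = -1.  Since 8 ∣ t, the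
-- shift changes neither the parity of d, nor ε_d (which depends on d mod 4),
-- nor (2^α/d) (which depends on d mod 8).  Hence the summand T satisfies
-- T(d + t) = -T(d), and a sum of such a T over 2^ℓ·(2t) = N consecutive
-- values of d is zero.

open import Defs

module Vanishing where

  open import Data.Nat as ℕ using (ℕ; zero; suc; NonZero; _∸_; _<ᵇ_; _≡ᵇ_; s≤s)
  import Data.Nat.Properties as ℕₚ
  import Data.Nat.DivMod as ℕ
  import Data.Nat.Divisibility as ℕ
  open import Data.Integer as ℤ
    using (ℤ; +_; 0ℤ; 1ℤ; -1ℤ; _%ℕ_; _/ℕ_; _+_; _*_; _-_; -_; ∣_∣)
  import Data.Integer.Properties as ℤₚ
  import Data.Integer.DivMod as ℤ
  import Data.Integer.Divisibility as Unsigned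
  import Data.Integer.Divisibility.Signed as Signed
  open import Data.Integer.Tactic.RingSolver using (solve-∀)
  open import Data.Nat.Tactic.RingSolver using () renaming (solve-∀ to ℕ-solve-∀)
  open import Data.Bool using (true; false; if_then_else_)
  open import Data.Fin as Fin using (Fin; toℕ)
  open import Data.List using (foldr; applyUpTo)
  open import Data.Product using (∃; _,_)
  open import Data.Sum using (_⊎_; inj₁; inj₂; [_,_]′)
  open import Function using (_∘_)
  open import Relation.Binary.PropositionalEquality
  open import Relation.Nullary using (¬_; contradiction)

  Σ< : ℕ → (ℕ → ℤ) → ℤ
  Σ< n G = sumFin {n} (G ∘ toℕ)

  sumFin-cong : ∀ {n} {f g : Fin n → ℤ} → (∀ i → f i ≡ g i) → sumFin f ≡ sumFin g
  sumFin-cong {zero}  f≗g = refl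
  sumFin-cong {suc n} f≗g = cong₂ _+_ (f≗g Fin.zero) (sumFin-cong (f≗g ∘ Fin.suc))

  sumFin-neg : ∀ {n} (f : Fin n → ℤ) → sumFin (λ i → - f i) ≡ - sumFin f
  sumFin-neg {zero}  f = refl
  sumFin-neg {suc n} f = begin
    - f Fin.zero + sumFin (λ i → - f (Fin.suc i)) ≡⟨ cong (λ s → - f Fin.zero + s) (sumFin-neg (f ∘ Fin.suc)) ⟩
    - f Fin.zero + - sumFin (f ∘ Fin.suc)         ≡⟨ ℤₚ.neg-distrib-+ (f Fin.zero) _ ⟨
    - sumFin f                                    ∎
    where open ≡-Reasoning

  Σ<-cong : ∀ n {G G′ : ℕ → ℤ} → (∀ d → G d ≡ G′ d) → Σ< n G ≡ Σ< n G′
  Σ<-cong n G≗G′ = sumFin-cong {n} (G≗G′ ∘ toℕ)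

  Σ<-split : ∀ p q G → Σ< (p ℕ.+ q) G ≡ Σ< p G + Σ< q (λ d → G (p ℕ.+ d))
  Σ<-split zero    q G = sym (ℤₚ.+-identityˡ _)
  Σ<-split (suc p) q G = trans (cong (_+_ (G 0)) (Σ<-split p q (G ∘ suc))) (sym (ℤₚ.+-assoc (G 0) _ _))

  -- A function that changes sign under the shift d ↦ d + t sums to zero over
  -- any multiple of the period 2t: each block of length 2t cancels.
  Σ<-antiperiodic : ∀ t (G : ℕ → ℤ) → (∀ d → G (d ℕ.+ t) ≡ - G d) →
                    ∀ M → Σ< (M ℕ.* (t ℕ.+ t)) G ≡ 0ℤ
  Σ<-antiperiodic t G anti zero    = refl
  Σ<-antiperiodic t G anti (suc M) = begin
    Σ< (t ℕ.+ t ℕ.+ M ℕ.* (t ℕ.+ t)) G                        ≡⟨ Σ<-split (t ℕ.+ t) _ G ⟩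
    Σ< (t ℕ.+ t) G + Σ< (M ℕ.* (t ℕ.+ t)) (G ∘ (t ℕ.+ t ℕ.+_)) ≡⟨ cong₂ _+_ block rest ⟩
    0ℤ + 0ℤ                                                  ∎
    where
    open ≡-Reasoning
    block : Σ< (t ℕ.+ t) G ≡ 0ℤ
    block = begin
      Σ< (t ℕ.+ t) G                            ≡⟨ Σ<-split t t G ⟩
      Σ< t G + Σ< t (λ d → G (t ℕ.+ d))         ≡⟨ cong (_+_ (Σ< t G)) (Σ<-cong t (λ d → trans (cong G (ℕₚ.+-comm t d)) (anti d))) ⟩
      Σ< t G + Σ< t (λ d → - G d)               ≡⟨ cong (_+_ (Σ< t G)) (sumFin-neg {t} (G ∘ toℕ)) ⟩
      Σ< t G - Σ< t G                           ≡⟨ ℤₚ.+-inverseʳ (Σ< t G) ⟩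
      0ℤ                                        ∎
    rest : Σ< (M ℕ.* (t ℕ.+ t)) (G ∘ (t ℕ.+ t ℕ.+_)) ≡ 0ℤ
    rest = Σ<-antiperiodic t (G ∘ (t ℕ.+ t ℕ.+_))
             (λ d → trans (cong G (sym (ℕₚ.+-assoc (t ℕ.+ t) d t))) (anti _)) M

  Opposite : ∀ {α} → Cyc α → Cyc α → Set
  Opposite x y = ∀ i → coeff x i ≡ - coeff y i

  ·C-opposite : ∀ {α} c {x y : Cyc α} → Opposite x y → Opposite (c ·C x) (c ·C y)
  ·C-opposite c x≈-y i = trans (cong (c *_) (x≈-y i)) (sym (ℤₚ.neg-distribʳ-* c _))

  *C-oppositeʳ : ∀ {α} (x : Cyc α) {y y′ : Cyc α} → Opposite y′ y → Opposite (x *C y′) (x *C y)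
  *C-oppositeʳ {α} x {y} {y′} y′≈-y i =
    trans (sumFin-cong (λ a →
             trans (sumFin-cong (λ b → term a b)) (sumFin-neg (λ b → product a b))))
          (sumFin-neg (λ a → sumFin (product a)))
    where
    product : Fin (half α) → Fin (half α) → ℤ
    product a b = (coeff x a * coeff y b) * coeff (zetaPow α (toℕ a ℕ.+ toℕ b)) i
    negate-middle : ∀ p q r → (p * - q) * r ≡ - ((p * q) * r)
    negate-middle = solve-∀
    term : ∀ a b → (coeff x a * coeff y′ b) * coeff (zetaPow α (toℕ a ℕ.+ toℕ b)) i ≡ - product a b
    term a b = trans (cong (λ z → (coeff x a * z) * ζ-coeff) (y′≈-y b)) (negate-middle (coeff x a) (coeff y b) ζ-coeff)
      where
      ζ-coeff : ℤ
      ζ-coeff = coeff (zetaPow α (toℕ a ℕ.+ toℕ b)) i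

  opposite-signs : ∀ {α} r → Opposite (-1ℤ ·C basis {α} r) (basis r)
  opposite-signs r i = ℤₚ.-1*i≡-i _

  opposite-sym : ∀ {α} {x y : Cyc α} → Opposite x y → Opposite y x
  opposite-sym {x = x} {y} x≈-y i = begin
    coeff y i         ≡⟨ ℤₚ.neg-involutive (coeff y i) ⟨
    - - coeff y i     ≡⟨ cong -_ (x≈-y i) ⟨
    - coeff x i       ∎
    where open ≡-Reasoning

  oddPart : ∀ {α} → (ℕ → Cyc α) → ℕ → Cyc α
  oddPart f d = if (d ℕ.% 2) ≡ᵇ 1 then f d else 0C

  coeff-sumOdd : ∀ {α} N (f : ℕ → Cyc α) i → coeff (sumOdd N f) i ≡ Σ< N (λ d → coeff (oddPart f d) i)
  coeff-sumOdd N f i = go (λ d → d) N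
    where
    go : ∀ g n → coeff (foldr (λ d acc → oddPart f d +C acc) 0C (applyUpTo g n)) i
               ≡ Σ< n (λ d → coeff (oddPart f (g d)) i)
    go g zero    = refl
    go g (suc n) = cong (_+_ (coeff (oddPart f (g 0)) i)) (go (g ∘ suc) n)

  multiple-below : ∀ {N n} → N ℕ.∣ n → n ℕ.< N → n ≡ 0
  multiple-below {n = zero}  _   _   = refl
  multiple-below {n = suc _} N∣n n<N = contradiction N∣n (ℕ.>⇒∤ n<N)

  %ℕ-unique : ∀ j N .{{_ : NonZero N}} r q → r ℕ.< N → j ≡ + r + q * + N → j %ℕ N ≡ r
  %ℕ-unique j N r q r<N j≡r+qN = ℤₚ.+-injective (ℤₚ.i-j≡0⇒i≡j _ _ r₀-r≡0)
    where
    r₀ : ℕ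
    r₀ = j %ℕ N
    q₀ : ℤ
    q₀ = j /ℕ N
    shift : ∀ x y c n → x - y ≡ (x + c * n) - (y + c * n)
    shift = solve-∀
    cancel : ∀ y c d n → (y + d * n) - (y + c * n) ≡ (d - c) * n
    cancel = solve-∀
    difference : + r₀ - + r ≡ (q - q₀) * + N
    difference = begin
      + r₀ - + r                           ≡⟨ shift (+ r₀) (+ r) q₀ (+ N) ⟩
      (+ r₀ + q₀ * + N) - (+ r + q₀ * + N) ≡⟨ cong (_- (+ r + q₀ * + N)) (trans (sym (ℤ.a≡a%ℕn+[a/ℕn]*n j N)) j≡r+qN) ⟩
      (+ r + q * + N) - (+ r + q₀ * + N)   ≡⟨ cancel (+ r) q₀ q (+ N) ⟩
      (q - q₀) * + N                       ∎
      where open ≡-Reasoning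
    divisible : N ℕ.∣ ∣ + r₀ - + r ∣
    divisible = ℕ.divides ∣ q - q₀ ∣ (trans (cong ∣_∣ difference) (ℤₚ.abs-* (q - q₀) (+ N)))
    small : ∣ + r₀ - + r ∣ ℕ.< N
    small = subst (ℕ._< N) (cong ∣_∣ (sym (ℤₚ.[+m]-[+n]≡m⊖n r₀ r)))
              (ℕₚ.≤-<-trans (ℤₚ.∣m⊝n∣≤m⊔n r₀ r) (ℕₚ.⊔-lub (ℤ.n%ℕd<d j N) r<N))
    r₀-r≡0 : + r₀ - + r ≡ 0ℤ
    r₀-r≡0 = ℤₚ.∣i∣≡0⇒i≡0 (multiple-below divisible small)

  module _ (a : ℕ) where
    private
      H N : ℕ
      H = 2 ℕ.^ a
      N = 2 ℕ.^ suc a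
      instance
        H-nonZero : NonZero H
        H-nonZero = ℕₚ.m^n≢0 2 a
        N-nonZero : NonZero N
        N-nonZero = ℕₚ.m^n≢0 2 (suc a)

    e-periodic : ∀ j k → e (suc a) (j + k * + N) ≡ e (suc a) j
    e-periodic j k = cong (zetaPow (suc a))
      (%ℕ-unique (j + k * + N) N (j %ℕ N) (j /ℕ N + k) (ℤ.n%ℕd<d j N)
        (trans (cong (_+ k * + N) (ℤ.a≡a%ℕn+[a/ℕn]*n j N)) (regroup (+ (j %ℕ N)) (j /ℕ N) k (+ N))))
      where
      regroup : ∀ x q k n → x + q * n + k * n ≡ x + (q + k) * n
      regroup = solve-∀

    signedBasis : ℕ → Cyc (suc a)
    signedBasis r = if r <ᵇ H then basis r else -1ℤ ·C basis (r ∸ H)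

    zetaPow-signedBasis : ∀ x → zetaPow (suc a) x ≡ signedBasis (x ℕ.% N)
    zetaPow-signedBasis x with x ℕ.% N
    ... | r with r <ᵇ H
    ...   | true  = refl
    ...   | false = refl

    signedBasis-low : ∀ r → r ℕ.< H → signedBasis r ≡ basis r
    signedBasis-low r r<H with r <ᵇ H | ℕₚ.<⇒<ᵇ r<H
    ... | true | _ = refl

    signedBasis-high : ∀ r → H ℕ.≤ r → signedBasis r ≡ -1ℤ ·C basis (r ∸ H)
    signedBasis-high r H≤r with r <ᵇ H | ℕₚ.<ᵇ⇒< r H
    ... | true  | r<H = contradiction (r<H _) (ℕₚ.≤⇒≯ H≤r)
    ... | false | _   = refl

    e-signedBasis : ∀ j r q → r ℕ.< N → j ≡ + r + q * + N → e (suc a) j ≡ signedBasis r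
    e-signedBasis j r q r<N j≡ = begin
      zetaPow (suc a) (j %ℕ N)  ≡⟨ cong (zetaPow (suc a)) (%ℕ-unique j N r q r<N j≡) ⟩
      zetaPow (suc a) r         ≡⟨ zetaPow-signedBasis r ⟩
      signedBasis (r ℕ.% N)     ≡⟨ cong signedBasis (ℕ.m<n⇒m%n≡m r<N) ⟩
      signedBasis r             ∎
      where open ≡-Reasoning

    -- ζ^H = -1, that is, the half turn e((j + H)/2H) = -e(j/2H).  Writing
    -- j ≡ r (mod 2H), both sides are ±ζ^(r mod H) with opposite signs.
    module _ (j : ℤ) where
      private
        r : ℕ
        r = j %ℕ N
        q : ℤ
        q = j /ℕ N
        r<N : r ℕ.< N
        r<N = ℤ.n%ℕd<d j N
        j≡ : j ≡ + r + q * + N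
        j≡ = ℤ.a≡a%ℕn+[a/ℕn]*n j N
        N≡H+H : N ≡ H ℕ.+ H
        N≡H+H = cong (H ℕ.+_) (ℕₚ.+-identityʳ H)
        +N≡+H++H : + N ≡ + H + + H
        +N≡+H++H = trans (cong +_ N≡H+H) (ℤₚ.pos-+ H H)

        move : ∀ x q n h → x + q * n + h ≡ (x + h) + q * n
        move = solve-∀
        wrap : ∀ x h q → x + h + q * (h + h) + h ≡ x + (q + 1ℤ) * (h + h)
        wrap = solve-∀

        -- for r < H, adding H to j adds H to its remainder
        e-shift-low : r ℕ.< H → e (suc a) (j + + H) ≡ -1ℤ ·C basis r
        e-shift-low r<H = begin
          e (suc a) (j + + H)                ≡⟨ e-signedBasis (j + + H) (r ℕ.+ H) q r+H<N j+H≡ ⟩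
          signedBasis (r ℕ.+ H)              ≡⟨ signedBasis-high (r ℕ.+ H) (ℕₚ.m≤n+m H r) ⟩
          -1ℤ ·C basis (r ℕ.+ H ∸ H)         ≡⟨ cong (λ s → -1ℤ ·C basis s) (ℕₚ.m+n∸n≡m r H) ⟩
          -1ℤ ·C basis r                     ∎
          where
          open ≡-Reasoning
          r+H<N : r ℕ.+ H ℕ.< N
          r+H<N = subst (r ℕ.+ H ℕ.<_) (sym N≡H+H) (ℕₚ.+-monoˡ-< H r<H)
          j+H≡ : j + + H ≡ + (r ℕ.+ H) + q * + N
          j+H≡ = begin
            j + + H               ≡⟨ cong (_+ + H) j≡ ⟩
            + r + q * + N + + H   ≡⟨ move (+ r) q (+ N) (+ H) ⟩
            (+ r + + H) + q * + N ≡⟨ cong (_+ q * + N) (sym (ℤₚ.pos-+ r H)) ⟩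
            + (r ℕ.+ H) + q * + N ∎

        -- for r ≥ H, adding H to j subtracts H from its remainder
        e-shift-high : H ℕ.≤ r → e (suc a) (j + + H) ≡ basis (r ∸ H)
        e-shift-high H≤r = begin
          e (suc a) (j + + H)  ≡⟨ e-signedBasis (j + + H) (r ∸ H) (q + 1ℤ) r-H<N j+H≡ ⟩
          signedBasis (r ∸ H)  ≡⟨ signedBasis-low (r ∸ H) r-H<H ⟩
          basis (r ∸ H)        ∎
          where
          open ≡-Reasoning
          r-H<N : r ∸ H ℕ.< N
          r-H<N = ℕₚ.≤-<-trans (ℕₚ.m∸n≤m r H) r<N
          r-H<H : r ∸ H ℕ.< H
          r-H<H = ℕₚ.m<n+o⇒m∸n<o r H (subst (r ℕ.<_) N≡H+H r<N)
          +r≡ : + r ≡ + (r ∸ H) + + H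
          +r≡ = trans (cong +_ (sym (ℕₚ.m∸n+n≡m H≤r))) (ℤₚ.pos-+ (r ∸ H) H)
          j+H≡ : j + + H ≡ + (r ∸ H) + (q + 1ℤ) * + N
          j+H≡ = begin
            j + + H                                 ≡⟨ cong (_+ + H) j≡ ⟩
            + r + q * + N + + H                     ≡⟨ cong₂ (λ x n → x + q * n + + H) +r≡ +N≡+H++H ⟩
            + (r ∸ H) + + H + q * (+ H + + H) + + H ≡⟨ wrap (+ (r ∸ H)) (+ H) q ⟩
            + (r ∸ H) + (q + 1ℤ) * (+ H + + H)      ≡⟨ cong (λ n → + (r ∸ H) + (q + 1ℤ) * n) (sym +N≡+H++H) ⟩
            + (r ∸ H) + (q + 1ℤ) * + N              ∎

      e-half-turn : Opposite (e (suc a) (j + + 2 ℕ.^ a)) (e (suc a) j)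
      e-half-turn = [ low , high ]′ (ℕₚ.<-≤-connex r H)
        where
        low : r ℕ.< H → Opposite (e (suc a) (j + + H)) (e (suc a) j)
        low r<H = subst₂ Opposite (sym (e-shift-low r<H)) (sym e-j) (opposite-signs {suc a} r)
          where
          e-j : e (suc a) j ≡ basis r
          e-j = trans (e-signedBasis j r q r<N j≡) (signedBasis-low r r<H)
        high : H ℕ.≤ r → Opposite (e (suc a) (j + + H)) (e (suc a) j)
        high H≤r = subst₂ Opposite (sym (e-shift-high H≤r)) (sym e-j) (opposite-sym {suc a} (opposite-signs {suc a} (r ∸ H)))
          where
          e-j : e (suc a) j ≡ -1ℤ ·C basis (r ∸ H)
          e-j = trans (e-signedBasis j r q r<N j≡) (signedBasis-high r H≤r)

  %-shift : ∀ d t n .{{_ : NonZero n}} → n ℕ.∣ t → (d ℕ.+ t) ℕ.% n ≡ d ℕ.% n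
  %-shift d _ n (ℕ.divides-refl k) = ℕ.[m+kn]%n≡m%n d k n

  jacobi2-cong : ∀ {d d′} → d ℕ.% 8 ≡ d′ ℕ.% 8 → jacobi2 d ≡ jacobi2 d′
  jacobi2-cong same rewrite same = refl

  jacobi2Pow-cong : ∀ α {d d′} → d ℕ.% 8 ≡ d′ ℕ.% 8 → jacobi2Pow α d ≡ jacobi2Pow α d′
  jacobi2Pow-cong zero    same = refl
  jacobi2Pow-cong (suc α) {d} {d′} same =
    cong₂ _*_ (jacobi2-cong {d} {d′} same) (jacobi2Pow-cong α {d} {d′} same)

  εPow-cong : ∀ α m {d d′} → d ℕ.% 4 ≡ d′ ℕ.% 4 → εPow α d m ≡ εPow α d′ m
  εPow-cong α m = cong (λ r → (if r ≡ᵇ 1 then 1C else iC α) ^C (m %ℕ 4))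

  parity : ∀ u → (∃ λ q → u ≡ q * + 2) ⊎ (∃ λ q → u ≡ 1ℤ + q * + 2)
  parity u with u %ℕ 2 | ℤ.n%ℕd<d u 2 | ℤ.a≡a%ℕn+[a/ℕn]*n u 2
  ... | 0           | _             | u≡ = inj₁ (u /ℕ 2 , trans u≡ (ℤₚ.+-identityˡ _))
  ... | 1           | _             | u≡ = inj₂ (u /ℕ 2 , u≡)
  ... | suc (suc _) | s≤s (s≤s ()) | _

  pow-+ : ∀ m n → + (2 ℕ.^ (m ℕ.+ n)) ≡ + (2 ℕ.^ m) * + (2 ℕ.^ n)
  pow-+ m n = trans (cong +_ (ℕₚ.^-distribˡ-+-* 2 m n)) (ℤₚ.pos-* (2 ℕ.^ m) (2 ℕ.^ n))

  exact-power-of-2 : ∀ h ℓ c → + (2 ℕ.^ ℓ) Unsigned.∣ h → ¬ (+ (2 ℕ.^ (ℓ ℕ.+ 1)) Unsigned.∣ h) →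
                     ∃ λ k → h * + (2 ℕ.^ c) ≡ + (2 ℕ.^ (ℓ ℕ.+ c)) + k * + (2 ℕ.^ suc (ℓ ℕ.+ c))
  exact-power-of-2 h ℓ c 2^ℓ∣h 2^ℓ⁺¹∤h with Signed.∣ᵤ⇒∣ 2^ℓ∣h
  ... | Signed.divides u h≡u2^ℓ = [ even , odd ]′ (parity u)
    where
    P C : ℤ
    P = + (2 ℕ.^ ℓ)
    C = + (2 ℕ.^ c)
    Target : Set
    Target = ∃ λ k → h * C ≡ + (2 ℕ.^ (ℓ ℕ.+ c)) + k * + (2 ℕ.^ suc (ℓ ℕ.+ c))
    even : (∃ λ q → u ≡ q * + 2) → Target
    even (q , u≡) = contradiction (Signed.∣⇒∣ᵤ (Signed.divides q h≡q2^ℓ⁺¹)) 2^ℓ⁺¹∤h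
      where
      regroup : ∀ q p → (q * + 2) * p ≡ q * (p * + 2)
      regroup = solve-∀
      h≡q2^ℓ⁺¹ : h ≡ q * + (2 ℕ.^ (ℓ ℕ.+ 1))
      h≡q2^ℓ⁺¹ = begin
        h                   ≡⟨ h≡u2^ℓ ⟩
        u * P               ≡⟨ cong (_* P) u≡ ⟩
        (q * + 2) * P       ≡⟨ regroup q P ⟩
        q * (P * + 2)       ≡⟨ cong (q *_) (pow-+ ℓ 1) ⟨
        q * + (2 ℕ.^ (ℓ ℕ.+ 1)) ∎
        where open ≡-Reasoning
    odd : (∃ λ q → u ≡ 1ℤ + q * + 2) → Target
    odd (q , u≡) = q , (begin
      h * C                                    ≡⟨ cong (_* C) (trans h≡u2^ℓ (cong (_* P) u≡)) ⟩
      (1ℤ + q * + 2) * P * C                   ≡⟨ expand q P C ⟩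
      P * C + q * (+ 2 * (P * C))              ≡⟨ cong₂ (λ x y → x + q * y) (sym (pow-+ ℓ c)) (cong (+ 2 *_) (sym (pow-+ ℓ c))) ⟩
      + (2 ℕ.^ (ℓ ℕ.+ c)) + q * (+ 2 * + (2 ℕ.^ (ℓ ℕ.+ c))) ≡⟨ cong (λ x → + (2 ℕ.^ (ℓ ℕ.+ c)) + q * x) (sym (ℤₚ.pos-* 2 (2 ℕ.^ (ℓ ℕ.+ c)))) ⟩
      + (2 ℕ.^ (ℓ ℕ.+ c)) + q * + (2 ℕ.^ suc (ℓ ℕ.+ c)) ∎)
      where
      open ≡-Reasoning
      expand : ∀ q p c → (1ℤ + q * + 2) * p * c ≡ p * c + q * (+ 2 * (p * c))
      expand = solve-∀

  summand : ∀ α → ℤ → ℤ → ℕ → Cyc α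
  summand α m h d = jacobi2Pow α d ·C (εPow α d m *C e α (h * + d))

  if-opposite : ∀ {α} b {x y : Cyc α} → Opposite x y →
                Opposite (if b then x else 0C) (if b then y else 0C)
  if-opposite true  x≈-y = x≈-y
  if-opposite false _    = λ _ → refl

  -- Suppose h·t ≡ H (mod N) and 8 ∣ t.  Then d ↦ d + t reverses the sign of
  -- e(hd/N) and fixes the parity of d and both characters, so it reverses
  -- the sign of every term of S.
  module _ (a : ℕ) (m h : ℤ) (t : ℕ) (8∣t : 8 ℕ.∣ t) (k : ℤ)
           (ht≡ : h * + t ≡ + (2 ℕ.^ a) + k * + (2 ℕ.^ suc a)) where

    e-antiperiodic : ∀ d → Opposite (e (suc a) (h * + (d ℕ.+ t))) (e (suc a) (h * + d))
    e-antiperiodic d = subst (λ x → Opposite x (e (suc a) (h * + d))) (sym e-shift) (e-half-turn a (h * + d))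
      where
      open ≡-Reasoning
      H N : ℤ
      H = + (2 ℕ.^ a)
      N = + (2 ℕ.^ suc a)
      exponent : h * + (d ℕ.+ t) ≡ h * + d + H + k * N
      exponent = begin
        h * + (d ℕ.+ t)        ≡⟨ cong (h *_) (ℤₚ.pos-+ d t) ⟩
        h * (+ d + + t)        ≡⟨ ℤₚ.*-distribˡ-+ h (+ d) (+ t) ⟩
        h * + d + h * + t      ≡⟨ cong (_+_ (h * + d)) ht≡ ⟩
        h * + d + (H + k * N)  ≡⟨ ℤₚ.+-assoc (h * + d) H (k * N) ⟨
        h * + d + H + k * N    ∎
      e-shift : e (suc a) (h * + (d ℕ.+ t)) ≡ e (suc a) (h * + d + H)
      e-shift = trans (cong (e (suc a)) exponent) (e-periodic a (h * + d + H) k)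

    summand-antiperiodic : ∀ d → Opposite (oddPart (summand (suc a) m h) (d ℕ.+ t))
                                          (oddPart (summand (suc a) m h) d)
    summand-antiperiodic d rewrite %-shift d t 2 (ℕ.∣-trans (ℕ.divides 4 refl) 8∣t) =
      if-opposite (d ℕ.% 2 ≡ᵇ 1) term
      where
      term : Opposite (summand (suc a) m h (d ℕ.+ t)) (summand (suc a) m h d)
      term rewrite jacobi2Pow-cong (suc a) {d ℕ.+ t} {d} (%-shift d t 8 8∣t)
                 | εPow-cong (suc a) m {d ℕ.+ t} {d} (%-shift d t 4 (ℕ.∣-trans (ℕ.divides 2 refl) 8∣t))
        = ·C-opposite {suc a} (jacobi2Pow (suc a) d) (*C-oppositeʳ (εPow (suc a) d m) (e-antiperiodic d))

  -- With α = ℓ + 4 + u put c = u + 3 and t = 2^c, so that α = ℓ + c + 1,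
  -- 8 ∣ t, h·t ≡ 2^(α-1) (mod 2^α), and the 2^α terms form 2^ℓ blocks of 2t.
  S-vanishes : ∀ m h ℓ → + (2 ℕ.^ ℓ) Unsigned.∣ h → ¬ (+ (2 ℕ.^ (ℓ ℕ.+ 1)) Unsigned.∣ h) →
               ∀ α → ℓ ℕ.+ 4 ℕ.≤ α → ∀ i → coeff (S α m h) i ≡ 0ℤ
  S-vanishes m h ℓ 2^ℓ∣h 2^ℓ⁺¹∤h α ℓ+4≤α with ℕₚ.m≤n⇒∃[o]m+o≡n ℓ+4≤α
  ... | u , refl = subst (λ β → ∀ i → coeff (S β m h) i ≡ 0ℤ) α≡ vanishes
    where
    c t α′ : ℕ
    c = u ℕ.+ 3
    t = 2 ℕ.^ c
    α′ = suc (ℓ ℕ.+ c)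
    reindex : ∀ ℓ u → suc (ℓ ℕ.+ (u ℕ.+ 3)) ≡ ℓ ℕ.+ 4 ℕ.+ u
    reindex = ℕ-solve-∀
    α≡ : α′ ≡ ℓ ℕ.+ 4 ℕ.+ u
    α≡ = reindex ℓ u
    8∣t : 8 ℕ.∣ t
    8∣t = ℕ.divides (2 ℕ.^ u) (ℕₚ.^-distribˡ-+-* 2 u 3)
    blocks : ∀ p q → 2 ℕ.* (p ℕ.* q) ≡ p ℕ.* (q ℕ.+ q)
    blocks = ℕ-solve-∀
    2^α≡ : 2 ℕ.^ α′ ≡ 2 ℕ.^ ℓ ℕ.* (t ℕ.+ t)
    2^α≡ = trans (cong (2 ℕ.*_) (ℕₚ.^-distribˡ-+-* 2 ℓ c)) (blocks (2 ℕ.^ ℓ) t)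
    vanishes : ∀ i → coeff (S α′ m h) i ≡ 0ℤ
    vanishes i with exact-power-of-2 h ℓ c 2^ℓ∣h 2^ℓ⁺¹∤h
    ... | k , ht≡ = begin
      coeff (S α′ m h) i                  ≡⟨ coeff-sumOdd (2 ℕ.^ α′) (summand α′ m h) i ⟩
      Σ< (2 ℕ.^ α′) T                     ≡⟨ cong (λ n → Σ< n T) 2^α≡ ⟩
      Σ< (2 ℕ.^ ℓ ℕ.* (t ℕ.+ t)) T        ≡⟨ Σ<-antiperiodic t T antiperiodic (2 ℕ.^ ℓ) ⟩
      0ℤ                                  ∎
      where
      open ≡-Reasoning
      T : ℕ → ℤ
      T d = coeff (oddPart (summand α′ m h) d) i
      antiperiodic : ∀ d → T (d ℕ.+ t) ≡ - T d
      antiperiodic d = summand-antiperiodic (ℓ ℕ.+ c) m h t 8∣t k ht≡ d i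

open Vanishing using (S-vanishes)
open import Data.Nat using (ℕ; _≤_; _+_; _^_)
open import Data.Integer using (ℤ; +_; 0ℤ)
open import Data.Integer.Divisibility using (_∣_)
open import Relation.Binary.PropositionalEquality using (_≡_; _≢_)
open import Relation.Nullary using (¬_)

mainTheorem15 : (m : ℤ) → ¬ (+ 2 ∣ m) → (h : ℤ) → h ≢ 0ℤ → (ℓ : ℕ) →
    (+ (2 ^ ℓ) ∣ h) → ¬ (+ (2 ^ (ℓ + 1)) ∣ h) → (α : ℕ) → ℓ + 4 ≤ α →
    ∀ i → coeff (S α m h) i ≡ 0ℤ
mainTheorem15 m _ h _ = S-vanishes m h
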